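{- For every $S\in\mathbf{Hrs}$: (i) for every $\alpha$ and every $\sigma$, if $\mathcal{W}^I_S(\sigma,\alpha)$ then $\alpha\in\mathcal{E}_S$; (ii) for every $\alpha$ and every $\tau$, if $\mathcal{W}^{II}_S(\tau,\alpha)$ then $\alpha\in\mathcal{A}_S$; (iii) for every $\alpha$, if $\alpha\in\mathcal{E}_S$, then for some $\sigma$, $\mathcal{W}^I_S(\sigma,\alpha)$; (iv) for every $\alpha$, if $\alpha\in\mathcal{A}_S$, then for some $\tau$, $\mathcal{W}^{II}_S(\tau,\alpha)$. (Here $\alpha,\sigma,\tau$ range over $\omega^\omega$.)
   Context: Setting: intuitionistic mathematics (intuitionistic logic), assuming the Second Axiom of Countable Choice (if $\forall m\exists\alpha\in\omega^\omega[mR\alpha]$ then there is $\alpha$ with $\forall m[mR\alpha^m]$, where $\alpha^m(k)=\alpha(\langle m\rangle\ast k)$) and induction over the inductively defined class $\mathbf{Hrs}$. Finite sequences of natural numbers are coded bijectively by natural numbers; $s\ast t$ is concatenation, $\langle\,\rangle$ the empty sequence, $\overline{s}n$ the initial segment of $s$ of length $n$, $t\sqsubset s$ means $t$ is a proper initial segment of $s$; $(m,n)$ denotes a fixed pairing bijection $\omega\times\omega\to\omega$. For $X\subseteq\omega$ and a code $s$: $X\upharpoonright s=\{t\mid s\ast t\in X\}$; for $\alpha\in\omega^\omega$: $(\alpha\upharpoonright s)(t)=\alpha(s\ast t)$. $\mathbf{Hrs}$ (hereditarily repetitive nonzero stumps) is the least class of subsets of $\omega$ such that $1^\ast:=\{\langle\,\rangle\}\in\mathbf{Hrs}$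 and, for every sequence $S_0,S_1,\dots$ in $\mathbf{Hrs}$, $\{\langle\,\rangle\}\cup\bigcup_{m,n}\langle(m,n)\rangle\ast S_n\in\mathbf{Hrs}$ (every element arises this way). For $S\in\mathbf{Hrs}$, its border is $S'=\{s\mid s\notin S\wedge\forall t[t\sqsubset s\rightarrow t\in S]\}$. Leading sets: $\mathcal{E}_{1^\ast}=\{\alpha\mid\exists n[\alpha(\langle n\rangle)\neq0]\}$, $\mathcal{A}_{1^\ast}=\{\alpha\mid\forall n[\alpha(\langle n\rangle)=0]\}$, and for $S\neq1^\ast$: $\mathcal{E}_S=\{\alpha\mid\exists n[\alpha\upharpoonright\langle n\rangle\in\mathcal{A}_{S\upharpoonright\langle n\rangle}]\}$, $\mathcal{A}_S=\{\alpha\mid\forall n[\alpha\upharpoonright\langle n\rangle\in\mathcal{E}_{S\upharpoonright\langle n\rangle}]\}$. Strategies: $s\in_I\sigma$ iff $\forall n[2n<\mathrm{length}(s)\rightarrow s(2n)=\sigma(\overline{s}(2n))]$; $s\in_{II}\tau$ iff $\forall n[2n+1<\mathrm{length}(s)\rightarrow s(2n+1)=\tau(\overline{s}(2n+1))]$. $\mathcal{W}^I_S(\sigma,\alpha)$ holds iff for all $s\in S'$ with $s\in_I\sigma$: if $\mathrm{length}(s)$ is even then $\alpha(s)=0$, and if $\mathrm{length}(s)$ is odd then $\alpha(s)\neq0$. $\mathcal{W}^{II}_S(\tau,\alpha)$ holds iff for all $s\in S'$ with $s\in_{II}\tau$: if $\mathrm{length}(s)$ is even then $\alpha(s)\neq0$,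 and if odd then $\alpha(s)=0$. -}

module Defs where

open import Data.Nat using (ℕ; zero; suc; _+_; _*_; _<_)
open import Data.List using (List; []; _∷_; [_]; _++_; length; take; lookup)
open import Data.Fin using (fromℕ<)
open import Data.Product using (_×_; _,_; proj₂; ∃)
open import Data.Unit using (⊤)
open import Data.Empty using (⊥)
open import Relation.Nullary using (¬_)
open import Relation.Binary.PropositionalEquality using (_≡_; _≢_)

-- Finite sequences of naturals are represented directly by List ℕ
-- (instead of via a bijective coding by naturals); elements of ω^ω
-- that are applied to (codes of) finite sequences are functions List ℕ → ℕ.
Seq : Set
Seq = List ℕ

Fun : Set
Fun = Seq → ℕ

-- A fixed bijection ℕ → ℕ × ℕ (inverse of the pairing (m,n)), the
-- Cantor diagonal enumeration (0,0),(1,0),(0,1),(2,0),(1,1),(0,2),...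
step : ℕ × ℕ → ℕ × ℕ
step (zero  , n) = (suc n , zero)
step (suc m , n) = (m , suc n)

unpair : ℕ → ℕ × ℕ
unpair zero    = (0 , 0)
unpair (suc k) = step (unpair k)

snd : ℕ → ℕ
snd k = proj₂ (unpair k)

-- Hereditarily repetitive nonzero stumps, as well-founded trees:
-- one      represents 1* = {⟨⟩}
-- node f   represents {⟨⟩} ∪ ⋃_{m,n} ⟨(m,n)⟩ * S_n   with S_n = f n.
data Hrs : Set where
  one  : Hrs
  node : (ℕ → Hrs) → Hrs

_∈S_ : Seq → Hrs → Set
[]      ∈S S      = ⊤
(k ∷ t) ∈S one    = ⊥
(k ∷ t) ∈S node f = t ∈S f (snd k)

child : (ℕ → Hrs) → ℕ → Hrs
child f k = f (snd k)

_⊏_ : Seq → Seq → Set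
t ⊏ s = ∃ λ n → n < length s × take n s ≡ t

_∈Border_ : Seq → Hrs → Set
s ∈Border S = ¬ (s ∈S S) × (∀ t → t ⊏ s → t ∈S S)

_↾_ : Fun → Seq → Fun
(α ↾ s) t = α (s ++ t)

mutual
  𝓔 : Hrs → Fun → Set
  𝓔 one      α = ∃ λ n → α [ n ] ≢ 0
  𝓔 (node f) α = ∃ λ n → 𝓐 (f (snd n)) (α ↾ [ n ])

  𝓐 : Hrs → Fun → Set
  𝓐 one      α = ∀ n → α [ n ] ≡ 0
  𝓐 (node f) α = ∀ n → 𝓔 (f (snd n)) (α ↾ [ n ])

_∈I_ : Seq → Fun → Set
s ∈I σ = ∀ n (p : 2 * n < length s) → lookup s (fromℕ< p) ≡ σ (take (2 * n) s)

_∈II_ : Seq → Fun → Set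
s ∈II τ = ∀ n (p : 2 * n + 1 < length s) → lookup s (fromℕ< p) ≡ τ (take (2 * n + 1) s)

WI : Hrs → Fun → Fun → Set
WI S σ α = ∀ s → s ∈Border S → s ∈I σ →
  (∀ k → length s ≡ 2 * k → α s ≡ 0) × (∀ k → length s ≡ 2 * k + 1 → α s ≢ 0)

WII : Hrs → Fun → Fun → Set
WII S τ α = ∀ s → s ∈Border S → s ∈II τ →
  (∀ k → length s ≡ 2 * k → α s ≢ 0) × (∀ k → length s ≡ 2 * k + 1 → α s ≡ 0)

-- On 1* a play is a single move. On node f a play starts with
-- a root move k and continues as a play on f (snd k) with the roles of the
-- players exchanged and the parity of lengths shifted by one, which mirrors
-- 𝓔 (node f) = ∃ 𝓐 (child) and 𝓐 (node f) = ∀ 𝓔 (child). In (iv) player II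
-- needs a winning strategy for player I on every child at once: this is the
-- use of countable choice, realised here by projecting out of the Σ-type.
module Submission where

open import Defs
open import Data.Product using (_×_; ∃; _,_; proj₁; proj₂)
open import Data.Nat using (ℕ; zero; suc; _+_; _*_; _<_; s≤s; z≤n; s<s⁻¹; pred)
open import Data.Nat.Properties using (+-comm; *-suc; 0≢1+n)
open import Data.List using ([]; _∷_; [_]; length; take; lookup)
open import Data.Fin using (fromℕ<)
open import Data.Unit using (tt)
open import Data.Empty using (⊥-elim)
open import Relation.Nullary using (¬_)
open import Relation.Binary.PropositionalEquality
  using (_≡_; _≢_; refl; sym; trans; cong; subst; module ≡-Reasoning)

open ≡-Reasoning

2m+1≡1+2m : ∀ m → 2 * m + 1 ≡ suc (2 * m)
2m+1≡1+2m m = +-comm (2 * m) 1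

2[1+m]≡1+[2m+1] : ∀ m → 2 * suc m ≡ suc (2 * m + 1)
2[1+m]≡1+[2m+1] m = trans (*-suc 2 m) (cong suc (sym (2m+1≡1+2m m)))

ByParity : ℕ → Set → Set → Set
ByParity n P Q = (∀ k → n ≡ 2 * k → P) × (∀ k → n ≡ 2 * k + 1 → Q)

module _ {n : ℕ} {P Q : Set} where

  byParity-pred : ByParity (suc n) P Q → ByParity n Q P
  byParity-pred (even , odd) =
    (λ k eq → odd k (trans (cong suc eq) (sym (2m+1≡1+2m k)))) ,
    (λ k eq → even (suc k) (trans (cong suc eq) (sym (2[1+m]≡1+[2m+1] k))))

  byParity-suc : ByParity n Q P → ByParity (suc n) P Q
  byParity-suc (even , odd) =
    (λ { zero () ; (suc k) eq → odd k (cong pred (trans eq (2[1+m]≡1+[2m+1] k))) }) ,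
    (λ k eq → even k (cong pred (trans eq (2m+1≡1+2m k))))

byParity-zero : {P Q : Set} → P → ByParity 0 P Q
byParity-zero p = (λ _ _ → p) , (λ k eq → ⊥-elim (0≢1+n (trans eq (2m+1≡1+2m k))))

byParity-one⁻ : {P Q : Set} → ByParity 1 P Q → Q
byParity-one⁻ b = proj₁ (byParity-pred b) 0 refl

byParity-one⁺ : {P Q : Set} → Q → ByParity 1 P Q
byParity-one⁺ q = byParity-suc (byParity-zero q)

lookup-fromℕ<-cong : ∀ (s : Seq) {i j} (p : i < length s) (q : j < length s) → i ≡ j →
                     lookup s (fromℕ< p) ≡ lookup s (fromℕ< q)
lookup-fromℕ<-cong s p q refl = refl

module _ {k : ℕ} {t : Seq} where

  ∈I-head : ∀ σ → (k ∷ t) ∈I σ → k ≡ σ []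
  ∈I-head σ h = h 0 (s≤s z≤n)

  ∈I-tail : ∀ σ → (k ∷ t) ∈I σ → t ∈II (σ ↾ [ k ])
  ∈I-tail σ h m p = begin
    lookup (k ∷ t) (fromℕ< (s≤s p))  ≡⟨ lookup-fromℕ<-cong (k ∷ t) (s≤s p) q (sym (2[1+m]≡1+[2m+1] m)) ⟩
    lookup (k ∷ t) (fromℕ< q)        ≡⟨ h (suc m) q ⟩
    σ (take (2 * suc m) (k ∷ t))     ≡⟨ cong (λ i → σ (take i (k ∷ t))) (2[1+m]≡1+[2m+1] m) ⟩
    σ (k ∷ take (2 * m + 1) t)       ∎
    where
    q : 2 * suc m < length (k ∷ t)
    q = subst (_< length (k ∷ t)) (sym (2[1+m]≡1+[2m+1] m)) (s≤s p)

  ∈I-cons : ∀ σ → k ≡ σ [] → t ∈II (σ ↾ [ k ]) → (k ∷ t) ∈I σ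
  ∈I-cons σ k≡σ[] h zero p = k≡σ[]
  ∈I-cons σ k≡σ[] h (suc m) p = begin
    lookup (k ∷ t) (fromℕ< p)         ≡⟨ lookup-fromℕ<-cong (k ∷ t) p (s≤s q) (2[1+m]≡1+[2m+1] m) ⟩
    lookup t (fromℕ< q)               ≡⟨ h m q ⟩
    σ (k ∷ take (2 * m + 1) t)        ≡⟨ cong (λ i → σ (take i (k ∷ t))) (sym (2[1+m]≡1+[2m+1] m)) ⟩
    σ (take (2 * suc m) (k ∷ t))      ∎
    where
    q : 2 * m + 1 < length t
    q = s<s⁻¹ (subst (_< length (k ∷ t)) (2[1+m]≡1+[2m+1] m) p)

  ∈II-tail : ∀ τ → (k ∷ t) ∈II τ → t ∈I (τ ↾ [ k ])
  ∈II-tail τ h m p = begin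
    lookup (k ∷ t) (fromℕ< (s≤s p))  ≡⟨ lookup-fromℕ<-cong (k ∷ t) (s≤s p) q (sym (2m+1≡1+2m m)) ⟩
    lookup (k ∷ t) (fromℕ< q)        ≡⟨ h m q ⟩
    τ (take (2 * m + 1) (k ∷ t))     ≡⟨ cong (λ i → τ (take i (k ∷ t))) (2m+1≡1+2m m) ⟩
    τ (k ∷ take (2 * m) t)           ∎
    where
    q : 2 * m + 1 < length (k ∷ t)
    q = subst (_< length (k ∷ t)) (sym (2m+1≡1+2m m)) (s≤s p)

  ∈II-cons : ∀ τ → t ∈I (τ ↾ [ k ]) → (k ∷ t) ∈II τ
  ∈II-cons τ h m p = begin
    lookup (k ∷ t) (fromℕ< p)         ≡⟨ lookup-fromℕ<-cong (k ∷ t) p (s≤s q) (2m+1≡1+2m m) ⟩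
    lookup t (fromℕ< q)               ≡⟨ h m q ⟩
    τ (k ∷ take (2 * m) t)            ≡⟨ cong (λ i → τ (take i (k ∷ t))) (sym (2m+1≡1+2m m)) ⟩
    τ (take (2 * m + 1) (k ∷ t))      ∎
    where
    q : 2 * m < length t
    q = s<s⁻¹ (subst (_< length (k ∷ t)) (2m+1≡1+2m m) p)

[]∈I : ∀ σ → [] ∈I σ
[]∈I σ n ()

[]∈II : ∀ τ → [] ∈II τ
[]∈II τ n ()

[]∉Border : ∀ {S} → ¬ ([] ∈Border S)
[]∉Border (∉S , _) = ∉S tt

border-one⁻ : ∀ {k t} → (k ∷ t) ∈Border one → t ≡ []
border-one⁻ {t = []} _ = refl
border-one⁻ {k} {_ ∷ _} (_ , prefixes∈S) = ⊥-elim (prefixes∈S [ k ] (1 , s≤s (s≤s z≤n) , refl))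

border-one⁺ : ∀ {k} → [ k ] ∈Border one
border-one⁺ = (λ ()) , λ
  { u (zero , _ , eq) → subst (_∈S one) eq tt
  ; u (suc n , s≤s () , _) }

module _ {f : ℕ → Hrs} {k : ℕ} {t : Seq} where

  border-node⁻ : (k ∷ t) ∈Border node f → t ∈Border f (snd k)
  border-node⁻ (∉S , prefixes∈S) =
    ∉S , λ { u (n , n<∣t∣ , eq) → prefixes∈S (k ∷ u) (suc n , s≤s n<∣t∣ , cong (k ∷_) eq) }

  border-node⁺ : t ∈Border f (snd k) → (k ∷ t) ∈Border node f
  border-node⁺ (∉S , prefixes∈S) = ∉S , λ
    { u (zero , _ , eq) → subst (_∈S node f) eq tt
    ; u (suc n , s≤s n<∣t∣ , eq) → subst (_∈S node f) eq (prefixes∈S (take n t) (n , n<∣t∣ , refl)) }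

WI-one⁻ : ∀ α σ → WI one σ α → α [ σ [] ] ≢ 0
WI-one⁻ α σ W = byParity-one⁻ (W [ σ [] ] border-one⁺ (∈I-cons σ refl ([]∈II (σ ↾ [ σ [] ]))))

WI-one⁺ : ∀ α σ → α [ σ [] ] ≢ 0 → WI one σ α
WI-one⁺ α σ α≢0 [] b _ = ⊥-elim ([]∉Border b)
WI-one⁺ α σ α≢0 (k ∷ t) b i with border-one⁻ b | ∈I-head σ i
... | refl | refl = byParity-one⁺ α≢0

WII-one⁻ : ∀ α τ → WII one τ α → ∀ n → α [ n ] ≡ 0
WII-one⁻ α τ W n = byParity-one⁻ (W [ n ] border-one⁺ (∈II-cons τ ([]∈I (τ ↾ [ n ]))))

WII-one⁺ : ∀ α τ → (∀ n → α [ n ] ≡ 0) → WII one τ α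
WII-one⁺ α τ α≡0 [] b _ = ⊥-elim ([]∉Border b)
WII-one⁺ α τ α≡0 (k ∷ t) b i with border-one⁻ b
... | refl = byParity-one⁺ (α≡0 k)

WI-node⁻ : ∀ f α σ → WI (node f) σ α → WII (f (snd (σ []))) (σ ↾ [ σ [] ]) (α ↾ [ σ [] ])
WI-node⁻ f α σ W t b i = byParity-pred (W (σ [] ∷ t) (border-node⁺ b) (∈I-cons σ refl i))

WI-node⁺ : ∀ f α σ → WII (f (snd (σ []))) (σ ↾ [ σ [] ]) (α ↾ [ σ [] ]) → WI (node f) σ α
WI-node⁺ f α σ W [] b _ = ⊥-elim ([]∉Border b)
WI-node⁺ f α σ W (k ∷ t) b i with ∈I-head σ i
... | refl = byParity-suc (W t (border-node⁻ b) (∈I-tail σ i))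

WII-node⁻ : ∀ f α τ → WII (node f) τ α → ∀ k → WI (f (snd k)) (τ ↾ [ k ]) (α ↾ [ k ])
WII-node⁻ f α τ W k t b i = byParity-pred (W (k ∷ t) (border-node⁺ b) (∈II-cons τ i))

WII-node⁺ : ∀ f α τ → (∀ k → WI (f (snd k)) (τ ↾ [ k ]) (α ↾ [ k ])) → WII (node f) τ α
WII-node⁺ f α τ W [] b _ = ⊥-elim ([]∉Border b)
WII-node⁺ f α τ W (k ∷ t) b i = byParity-suc (W k t (border-node⁻ b) (∈II-tail τ i))

branch : ℕ → (ℕ → Fun) → Fun
branch n g []      = n
branch n g (k ∷ u) = g k u

mutual
  WI⇒𝓔 : ∀ S α σ → WI S σ α → 𝓔 S α
  WI⇒𝓔 one      α σ W = σ [] , WI-one⁻ α σ W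
  WI⇒𝓔 (node f) α σ W = σ [] , WII⇒𝓐 _ _ (σ ↾ [ σ [] ]) (WI-node⁻ f α σ W)

  WII⇒𝓐 : ∀ S α τ → WII S τ α → 𝓐 S α
  WII⇒𝓐 one      α τ W   = WII-one⁻ α τ W
  WII⇒𝓐 (node f) α τ W k = WI⇒𝓔 _ _ (τ ↾ [ k ]) (WII-node⁻ f α τ W k)

mutual
  𝓔⇒WI : ∀ S α → 𝓔 S α → ∃ λ σ → WI S σ α
  𝓔⇒WI one      α (n , α≢0) = (λ _ → n) , WI-one⁺ α (λ _ → n) α≢0
  𝓔⇒WI (node f) α (n , a) =
    let τ , W = 𝓐⇒WII _ _ a in branch n (λ _ → τ) , WI-node⁺ f α (branch n (λ _ → τ)) W

  -- Player II never moves at the root, so the root value 0 of τ is arbitrary.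
  𝓐⇒WII : ∀ S α → 𝓐 S α → ∃ λ τ → WII S τ α
  𝓐⇒WII one      α a = (λ _ → 0) , WII-one⁺ α (λ _ → 0) a
  𝓐⇒WII (node f) α a = τ , WII-node⁺ f α τ (λ k → proj₂ (𝓔⇒WI _ _ (a k)))
    where
    τ : Fun
    τ = branch 0 (λ k → proj₁ (𝓔⇒WI _ _ (a k)))

theorem3p9 : (S : Hrs) →
    ((α σ : Fun) → WI S σ α → 𝓔 S α) ×
    ((α τ : Fun) → WII S τ α → 𝓐 S α) ×
    ((α : Fun) → 𝓔 S α → ∃ λ σ → WI S σ α) ×
    ((α : Fun) → 𝓐 S α → ∃ λ τ → WII S τ α)
theorem3p9 S = WI⇒𝓔 S , WII⇒𝓐 S , 𝓔⇒WI S , 𝓐⇒WII S
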